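{- Let $A$ be a setoid, $B$ a setoid family over $A$, $a:A$ and $f:B\,a\Rightarrow W$. Then the tree $\mathsf{sup}\,a\,(\lambda b.\,\mathrm{pr}_1(f_0\,b)):\mathrm{W}(A_0,B_0)$ is extensional, i.e. $\mathcal{W}_B$ applied twice to it is inhabited; hence it yields an element $\mathsf{s}\,(a,f):W$.
   Context: Setting: intensional Martin-Löf type theory with $\Pi$-types and a universe $\mathsf{U}$ closed under $\Pi$ and containing intensional $\Sigma$-types, identity types, the unit type, W-types and dependent W-types; logic is propositions-as-types. A setoid $X$ is a tuple $(X_0,\approx_X,r_X,s_X,t_X)$ with $X_0:\mathsf{U}$, $\approx_X:X_0\to X_0\to\mathsf{U}$ and witnesses of reflexivity, symmetry, transitivity; $x:X$ means $x:X_0$. An extensional function $f:X\Rightarrow Y$ is $f_0:X_0\to Y_0$ with a proof of $\prod_{x,x'}x\approx x'\to f_0x\approx f_0x'$. A setoid family $B$ over a setoid $A$ gives a setoid $B\,a$ (underlying type $B_0a$) for $a:A$ and extensional transports $B_\alpha:B\,a\Rightarrow B\,a'$ for $\alpha:a\approx_Aa'$, functorial up to $\approx$, with $B_\alpha\approx B_{\alpha'}$ for all $\alpha,\alpha':a\approx a'$. Write $b\approx_\alpha b'$ for $B_\alpha b\approx b'$. $\mathrm{W}=\mathrm{W}(A_0,B_0)$ is the W-type with constructor $\mathsf{sup}$, and $\mathsf{n}(\mathsf{sup}\,a\,f)\equiv a$, $\mathsf{b}(\mathsf{sup}\,a\,f)\equiv f$. $\mathcal{W}_B:\mathrm{W}\to\mathrm{W}\to\mathsf{U}$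 is the inductive family with single constructor $\mathsf{dsup}\,(w,w')\,\alpha\,\phi:\mathcal{W}_B\,w\,w'$ for $\alpha:\mathsf{n}w\approx_A\mathsf{n}w'$ and $\phi:\prod_{(b,b',\beta):\sum_{b,b'}b\approx_\alpha b'}\mathcal{W}_B(\mathsf{b}\,w\,b)(\mathsf{b}\,w'\,b')$. A tree $w:\mathrm{W}$ is extensional if $\mathcal{W}_B\,w\,w$ is inhabited. The setoid $W$ has underlying type $\sum_{w:\mathrm{W}}\mathcal{W}_B\,w\,w$ and $(w,\_)\approx_W(w',\_):=\mathcal{W}_B\,w\,w'$. -}

module Defs where

open import Data.Product using (Σ; _,_; proj₁; proj₂; Σ-syntax)

record Setoid : Set₁ where
  field
    Car  : Set
    _≈_  : Car → Car → Set
    refl  : ∀ x → x ≈ x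
    sym   : ∀ {x y} → x ≈ y → y ≈ x
    trans : ∀ {x y z} → x ≈ y → y ≈ z → x ≈ z
open Setoid public using (Car)

record ExtFun (X : Setoid) (Y₀ : Set) (_≈Y_ : Y₀ → Y₀ → Set) : Set where
  field
    ap  : Car X → Y₀
    ext : ∀ x x' → Setoid._≈_ X x x' → ap x ≈Y ap x'
open ExtFun public

_⇒_ : Setoid → Setoid → Set
X ⇒ Y = ExtFun X (Car Y) (Setoid._≈_ Y)

record Family (A : Setoid) : Set₁ where
  open Setoid A using () renaming (_≈_ to _≈A_; refl to rA; trans to tA)
  field
    fib   : Car A → Setoid
    tr    : ∀ {a a'} → a ≈A a' → fib a ⇒ fib a'
    tr-id : ∀ a (b : Car (fib a)) → Setoid._≈_ (fib a) (ap (tr (rA a)) b) b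
    tr-∘  : ∀ {a a' a''} (α : a ≈A a') (α' : a' ≈A a'') (b : Car (fib a)) →
            Setoid._≈_ (fib a'') (ap (tr (tA α α')) b) (ap (tr α') (ap (tr α) b))
    tr-pi : ∀ {a a'} (α α' : a ≈A a') (b : Car (fib a)) →
            Setoid._≈_ (fib a') (ap (tr α) b) (ap (tr α') b)

  B₀ : Car A → Set
  B₀ a = Car (fib a)

  _≈[_]_ : ∀ {a a'} → B₀ a → a ≈A a' → B₀ a' → Set
  _≈[_]_ {a' = a'} b α b' = Setoid._≈_ (fib a') (ap (tr α) b) b'

data W (A₀ : Set) (B₀ : A₀ → Set) : Set where
  sup : (a : A₀) → (B₀ a → W A₀ B₀) → W A₀ B₀

module _ {A : Setoid} (B : Family A) where
  open Setoid A using () renaming (_≈_ to _≈A_)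
  open Family B

  WT : Set
  WT = W (Car A) B₀

  n : WT → Car A
  n (sup a f) = a

  b : (w : WT) → B₀ (n w) → WT
  b (sup a f) = f

  data 𝒲 : WT → WT → Set where
    dsup : (w w' : WT) (α : n w ≈A n w') →
           ((p : Σ[ x ∈ B₀ (n w) ] Σ[ x' ∈ B₀ (n w') ] (x ≈[ α ] x')) →
              𝒲 (b w (proj₁ p)) (b w' (proj₁ (proj₂ p)))) →
           𝒲 w w'

  -- Underlying type and equality of the setoid W.
  W₀ : Set
  W₀ = Σ[ w ∈ WT ] 𝒲 w w

  _≈W_ : W₀ → W₀ → Set
  (w , _) ≈W (w' , _) = 𝒲 w w'

  Extensional : WT → Set
  Extensional w = 𝒲 w w

module Submission where

open import Defs
open import Data.Product using (proj₁; _,_)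

-- A tree  sup a g  is extensional as soon as its
-- branches respect the relation on the fibre B a: to build 𝒲 (sup a g) (sup a g)
-- one takes reflexivity α := r a at the root and must relate  g x  and  g x'
-- whenever  x ≈[ α ] x',  i.e. whenever  tr (r a) x ≈ x'.  Since transport
-- along reflexivity is the identity up to ≈ (the law tr-id), such x, x' are
-- already equal in the fibre, so extensionality of f finishes the argument.

module _ {A : Setoid} (B : Family A) where
  open Setoid A using () renaming (refl to reflA)
  open Family B

  reflexive-transport : ∀ a {x x' : B₀ a} → x ≈[ reflA a ] x' → Setoid._≈_ (fib a) x x'
  reflexive-transport a {x} β =
    Setoid.trans (fib a) (Setoid.sym (fib a) (tr-id a x)) β

  sup-extensional : ∀ a (g : B₀ a → WT B) →
                    (∀ x x' → Setoid._≈_ (fib a) x x' → 𝒲 B (g x) (g x')) →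
                    Extensional B (sup a g)
  sup-extensional a g g-ext =
    dsup (sup a g) (sup a g) (reflA a)
      (λ { (x , x' , β) → g-ext x x' (reflexive-transport a β) })

lemma3p4 : (A : Setoid) (B : Family A) (a : Car A)
    (f : ExtFun (Family.fib B a) (W₀ B) (_≈W_ B)) →
    Extensional B (sup a (λ x → proj₁ (ap f x)))
lemma3p4 A B a f = sup-extensional B a (λ x → proj₁ (ap f x)) (ext f)
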